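{- The following hold: (1) $VS^{(D)}_{n,k}(t)=VS^{(D)}_{n,k-1}(t)+t^{ -1}VS^{(B)}_{n-1,k-1}(t)$ for $1<k\le n$; (2) $VS^{(B)}_{n,n}(t)=t^2\,VS^{(D)}_{n,n}(t)$ for $n\ge 2$; (3) $VS^{(B)}_{n,k}(t)=VS^{(B)}_{n,k+1}(t)+t\,VS^{(D)}_{n-1,k}(t)$ for $1\le k<n$.
   Context: Signed permutations of $[n]$ are written in window notation $\sigma=\sigma_1\cdots\sigma_n$ (entries in $\{\pm1,\dots,\pm n\}$, absolute values a permutation of $[n]$); $\bar a=-a$; $|\sigma|=|\sigma_1|\cdots|\sigma_n|$. For a sequence $w=w_1\cdots w_n$ of distinct positive integers, position $i$ (or $w_i$) is a valley if $2\le i\le n-1$ and $w_{i-1}>w_i<w_{i+1}$, or $i=1$ and $w_1<w_2$. $\mathcal{VS}^{(B)}_n$: signed permutations $\sigma$ such that whenever $\sigma_i<0$, we have $i\ge2$ and $|\sigma_{i-1}|$ is a valley of $|\sigma|$. $\mathcal{VS}^{(B)}_{n,k}$: those with $\sigma_1=k$. $\mathcal{VS}^{(D)}_n$: signed permutations with $\sigma_1<0$, $|\sigma_1|>\sigma_2>0$ (when $n\ge2$), and such that for $i\ge3$, $\sigma_i<0$ implies $|\sigma_{i-1}|$ is a valley of $|\sigma|$. $\mathcal{VS}^{(D)}_{n,k}$: those with $\sigma_1=\bar k$. $\mathsf{neg}(\sigma)=\#\{i:\sigma_i<0\}$; $VS^{(B)}_{n,k}(t)=\sum_{\sigma\in\mathcal{VS}^{(B)}_{n,k}}t^{n+1-2\mathsf{neg}(\sigma)}$,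 $VS^{(D)}_{n,k}(t)=\sum_{\sigma\in\mathcal{VS}^{(D)}_{n,k}}t^{n+1-2\mathsf{neg}(\sigma)}$. -}

module Defs where

open import Data.Bool using (Bool; true; false; _∧_; _∨_; not; if_then_else_)
open import Data.Nat using (ℕ; zero; suc; _+_; _*_; _∸_; _<ᵇ_; _≡ᵇ_)
open import Data.Integer using (ℤ; +_; -[1+_]; -_; _-_; ∣_∣)
import Data.Integer as ℤ
open import Data.List using (List; []; _∷_; map; concatMap; length; filter; upTo; foldr)
open import Relation.Nullary.Decidable using (⌊_⌋)

-- Signed permutations of [n] in window notation: lists of integers.

insertions : ℕ → List ℕ → List (List ℕ)
insertions x [] = (x ∷ []) ∷ []
insertions x (y ∷ ys) = (x ∷ y ∷ ys) ∷ map (y ∷_) (insertions x ys)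

perms : List ℕ → List (List ℕ)
perms [] = [] ∷ []
perms (x ∷ xs) = concatMap (insertions x) (perms xs)

signings : List ℕ → List (List ℤ)
signings [] = [] ∷ []
signings (a ∷ as) = concatMap (λ s → (+ a ∷ s) ∷ (- (+ a) ∷ s) ∷ []) (signings as)

range1 : ℕ → List ℕ
range1 n = map suc (upTo n)

signedPerms : ℕ → List (List ℤ)
signedPerms n = concatMap signings (perms (range1 n))

-- 1-based lookup with default 0 (entries of interest are never 0)
nth : {A : Set} → A → List A → ℕ → A
nth d [] _ = d
nth d (x ∷ xs) zero = d
nth d (x ∷ xs) (suc zero) = x
nth d (x ∷ xs) (suc (suc i)) = nth d xs (suc i)

isNeg : ℤ → Bool
isNeg (+ _) = false
isNeg -[1+ _ ] = true

isPos : ℤ → Bool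
isPos (+ zero) = false
isPos (+ suc _) = true
isPos -[1+ _ ] = false

allᵇ : {A : Set} → (A → Bool) → List A → Bool
allᵇ p = foldr (λ x b → p x ∧ b) true

_≤ᵇ_ : ℕ → ℕ → Bool
m ≤ᵇ n = m <ᵇ suc n

absW : List ℤ → List ℕ
absW = map ∣_∣

-- position i (1-based) is a valley of w = w_1 ... w_n:
--   2 ≤ i ≤ n-1 and w_{i-1} > w_i < w_{i+1},  or  i = 1 and w_1 < w_2 (n ≥ 2)
isValley : List ℕ → ℕ → Bool
isValley w zero = false
isValley w (suc zero) = (2 ≤ᵇ length w) ∧ (nth 0 w 1 <ᵇ nth 0 w 2)
isValley w (suc (suc j)) =
  let i = suc (suc j) in
  (suc i ≤ᵇ length w) ∧ (nth 0 w i <ᵇ nth 0 w (suc j)) ∧ (nth 0 w i <ᵇ nth 0 w (suc i))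

neg : List ℤ → ℕ
neg σ = length (filter (λ x → isNeg x Data.Bool.≟ true) σ)
  where import Data.Bool

inVSB : List ℤ → Bool
inVSB σ = allᵇ (λ i → not (isNeg (nth (+ 0) σ i)) ∨ ((2 ≤ᵇ i) ∧ isValley (absW σ) (i ∸ 1)))
               (range1 (length σ))

inVSD : List ℤ → Bool
inVSD σ =
  (1 ≤ᵇ length σ) ∧ isNeg (nth (+ 0) σ 1)
  ∧ (not (2 ≤ᵇ length σ) ∨ (isPos (nth (+ 0) σ 2) ∧ (∣ nth (+ 0) σ 2 ∣ <ᵇ ∣ nth (+ 0) σ 1 ∣)))
  ∧ allᵇ (λ i → not (3 ≤ᵇ i) ∨ not (isNeg (nth (+ 0) σ i)) ∨ isValley (absW σ) (i ∸ 1))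
         (range1 (length σ))

-- Laurent polynomials in t with ℕ coefficients, represented by their
-- coefficient function: p e = coefficient of t^e.

Laurent : Set
Laurent = ℤ → ℕ

_⊕_ : Laurent → Laurent → Laurent
(p ⊕ q) e = p e + q e

tpow·_ : ℤ → Laurent → Laurent
(tpow· m) p e = p (e - m)

_≈L_ : Laurent → Laurent → Set
p ≈L q = ∀ e → p e ≡ q e
  where open import Relation.Binary.PropositionalEquality using (_≡_)

infixl 6 _⊕_
infix 4 _≈L_

count : {A : Set} → (A → Bool) → List A → ℕ
count p [] = 0
count p (x ∷ xs) = (if p x then 1 else 0) + count p xs

expo : ℕ → List ℤ → ℤ
expo n σ = + (suc n) - + (2 * neg σ)

VSB : ℕ → ℕ → Laurent
VSB n k e = count (λ σ → inVSB σ ∧ (1 ≤ᵇ length σ) ∧ ⌊ nth (+ 0) σ 1 ℤ.≟ + k ⌋ ∧ ⌊ expo n σ ℤ.≟ e ⌋)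
                  (signedPerms n)

VSD : ℕ → ℕ → Laurent
VSD n k e = count (λ σ → inVSD σ ∧ (1 ≤ᵇ length σ) ∧ ⌊ nth (+ 0) σ 1 ℤ.≟ - (+ k) ⌋ ∧ ⌊ expo n σ ℤ.≟ e ⌋)
                  (signedPerms n)

-- Grouping signed permutations by |σ| turns VS^(B)_{n,k} and VS^(D)_{n,k} into sums, over the
-- permutations w of [n] starting with k, of a weight counting the admissible signings of w by
-- their number of negative entries; this weight only sees how adjacent entries of w compare.
-- Exchanging the values k and k+1 in w therefore keeps the weight unless k and k+1 are the first
-- two entries, and there the surplus is the weight of a word of the other type on n-1 letters
-- (drop one of the two values and renumber): this gives (1) and (3). For (2), a first entry n is
-- never a valley and exceeds σ₂, so changing its sign maps VS^(B)_{n,n} onto VS^(D)_{n,n}.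

module Submission where

open import Defs
open import Data.Bool using (Bool; true; false; _∧_; _∨_; not; if_then_else_; T)
open import Data.Bool.Properties using (∧-zeroʳ; ∨-zeroʳ; ∨-identityʳ)
open import Data.Empty using (⊥-elim)
open import Data.Integer as ℤ using (ℤ; +_; -[1+_]; -_; ∣_∣)
import Data.Integer.Properties as ℤP
open import Data.Integer.Tactic.RingSolver using (solve-∀)
open import Data.List using (List; []; _∷_; map; concatMap; length; _++_; upTo; applyUpTo)
import Data.List.Properties as ListP
open import Data.List.Membership.Propositional using (_∈_)
open import Data.List.Relation.Unary.Any using (here; there)
open import Data.List.Relation.Unary.All as All using (All; []; _∷_)
open import Data.List.Relation.Unary.All.Properties using (++⁺; map⁺; concat⁺)
open import Data.Nat using (ℕ; zero; suc; _+_; _*_; _∸_; _<_; _≤_; _≮_; _<ᵇ_; _≡ᵇ_; s≤s)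
import Data.Nat.Properties as ℕP
open import Algebra.Properties.CommutativeSemigroup ℕP.+-commutativeSemigroup using (interchange)
open import Data.Product using (_×_; _,_)
open import Data.Unit using (⊤; tt)
open import Function using (id; _∘_; mk⇔)
open import Relation.Binary.PropositionalEquality
open import Relation.Binary.Definitions using (tri<; tri≈; tri>)
open import Relation.Nullary using (does; yes; no)
open import Relation.Nullary.Decidable using (⌊_⌋; isYes≗does; dec-true; dec-false; does-⇔; T?)

private variable A B : Set

≡ᵇ-refl : ∀ k → (k ≡ᵇ k) ≡ true
≡ᵇ-refl k = dec-true (T? (k ≡ᵇ k)) (ℕP.≡⇒≡ᵇ k k refl)

≢⇒≡ᵇ-false : ∀ {x y} → x ≢ y → (x ≡ᵇ y) ≡ false
≢⇒≡ᵇ-false {x} {y} x≢y = dec-false (T? (x ≡ᵇ y)) (x≢y ∘ ℕP.≡ᵇ⇒≡ x y)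

≡ᵇ-true⇒≡ : ∀ {x y} → (x ≡ᵇ y) ≡ true → x ≡ y
≡ᵇ-true⇒≡ {x} {y} eq = ℕP.≡ᵇ⇒≡ x y (subst T (sym eq) tt)

≡ᵇ-false⇒≢ : ∀ {x y} → (x ≡ᵇ y) ≡ false → x ≢ y
≡ᵇ-false⇒≢ {x} eq refl with () ← trans (sym (≡ᵇ-refl x)) eq

<⇒<ᵇ-true : ∀ {x y} → x < y → (x <ᵇ y) ≡ true
<⇒<ᵇ-true {x} {y} x<y = dec-true (T? (x <ᵇ y)) (ℕP.<⇒<ᵇ x<y)

≮⇒<ᵇ-false : ∀ {x y} → x ≮ y → (x <ᵇ y) ≡ false
≮⇒<ᵇ-false {x} {y} x≮y = dec-false (T? (x <ᵇ y)) (x≮y ∘ ℕP.<ᵇ⇒< x y)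

<ᵇ-true⇒< : ∀ {x y} → (x <ᵇ y) ≡ true → x < y
<ᵇ-true⇒< {x} {y} eq = ℕP.<ᵇ⇒< x y (subst T (sym eq) tt)

<ᵇ-false⇒≮ : ∀ {x y} → (x <ᵇ y) ≡ false → x ≮ y
<ᵇ-false⇒≮ eq x<y = subst T eq (ℕP.<⇒<ᵇ x<y)

<ᵇ-cong-⇔ : ∀ {x y x′ y′} → (x < y → x′ < y′) → (x′ < y′ → x < y) →
            (x <ᵇ y) ≡ (x′ <ᵇ y′)
<ᵇ-cong-⇔ {x} {y} {x′} {y′} to from =
  does-⇔ (mk⇔ (ℕP.<⇒<ᵇ ∘ to ∘ ℕP.<ᵇ⇒< x y) (ℕP.<⇒<ᵇ ∘ from ∘ ℕP.<ᵇ⇒< x′ y′)) (T? _) (T? _)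

sumBy : (A → ℕ) → List A → ℕ
sumBy f [] = 0
sumBy f (x ∷ xs) = f x + sumBy f xs

sumBy-++ : (f : A → ℕ) (xs ys : List A) → sumBy f (xs ++ ys) ≡ sumBy f xs + sumBy f ys
sumBy-++ f [] ys = refl
sumBy-++ f (x ∷ xs) ys =
  trans (cong (_+_ (f x)) (sumBy-++ f xs ys)) (sym (ℕP.+-assoc (f x) (sumBy f xs) (sumBy f ys)))

sumBy-cong : {f g : A → ℕ} (xs : List A) → (∀ x → f x ≡ g x) → sumBy f xs ≡ sumBy g xs
sumBy-cong [] eq = refl
sumBy-cong (x ∷ xs) eq = cong₂ _+_ (eq x) (sumBy-cong xs eq)

sumBy-cong-∈ : {f g : A → ℕ} (xs : List A) → (∀ {x} → x ∈ xs → f x ≡ g x) →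
               sumBy f xs ≡ sumBy g xs
sumBy-cong-∈ [] eq = refl
sumBy-cong-∈ (x ∷ xs) eq = cong₂ _+_ (eq (here refl)) (sumBy-cong-∈ xs (eq ∘ there))

sumBy-+ : (f g : A → ℕ) (xs : List A) → sumBy (λ x → f x + g x) xs ≡ sumBy f xs + sumBy g xs
sumBy-+ f g [] = refl
sumBy-+ f g (x ∷ xs) =
  trans (cong (_+_ (f x + g x)) (sumBy-+ f g xs)) (interchange (f x) (g x) (sumBy f xs) (sumBy g xs))

sumBy-map : (f : B → ℕ) (g : A → B) (xs : List A) → sumBy f (map g xs) ≡ sumBy (f ∘ g) xs
sumBy-map f g [] = refl
sumBy-map f g (x ∷ xs) = cong (_+_ (f (g x))) (sumBy-map f g xs)

sumBy-concatMap : (f : B → ℕ) (g : A → List B) (xs : List A) →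
                  sumBy f (concatMap g xs) ≡ sumBy (sumBy f ∘ g) xs
sumBy-concatMap f g [] = refl
sumBy-concatMap f g (x ∷ xs) =
  trans (sumBy-++ f (g x) (concatMap g xs)) (cong (_+_ (sumBy f (g x))) (sumBy-concatMap f g xs))

sumBy-if : (b : Bool) (f : A → ℕ) (xs : List A) →
           sumBy (λ x → if b then f x else 0) xs ≡ (if b then sumBy f xs else 0)
sumBy-if true f xs = refl
sumBy-if false f [] = refl
sumBy-if false f (x ∷ xs) = sumBy-if false f xs

count≡sumBy : (p : A → Bool) (xs : List A) → count p xs ≡ sumBy (λ x → if p x then 1 else 0) xs
count≡sumBy p [] = refl
count≡sumBy p (x ∷ xs) = cong (_+_ (if p x then 1 else 0)) (count≡sumBy p xs)

count-cong-local : {p q : A → Bool} {xs : List A} → All (λ x → p x ≡ q x) xs → count p xs ≡ count q xs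
count-cong-local [] = refl
count-cong-local (eq ∷ eqs) = cong₂ (λ b n → (if b then 1 else 0) + n) eq (count-cong-local eqs)

count-const-false : (p : A → Bool) (xs : List A) → (∀ x → p x ≡ false) → count p xs ≡ 0
count-const-false p [] eq = refl
count-const-false p (x ∷ xs) eq rewrite eq x = count-const-false p xs eq

count-∧ˡ : (b : Bool) (p : A → Bool) (xs : List A) →
           count (λ x → b ∧ p x) xs ≡ (if b then count p xs else 0)
count-∧ˡ true p xs = refl
count-∧ˡ false p xs = count-const-false _ xs (λ _ → refl)

count-concatMap : (p : B → Bool) (g : A → List B) (xs : List A) →
                  count p (concatMap g xs) ≡ sumBy (count p ∘ g) xs
count-concatMap p g xs =
  trans (count≡sumBy p (concatMap g xs))
 (trans (sumBy-concatMap _ g xs) (sumBy-cong xs (λ x → sym (count≡sumBy p (g x)))))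

insertions-All : {P : ℕ → Set} {x : ℕ} (v : List ℕ) → P x → All P v → All (All P) (insertions x v)
insertions-All [] px [] = (px ∷ []) ∷ []
insertions-All (y ∷ v) px (py ∷ pv) =
  (px ∷ py ∷ pv) ∷ map⁺ (All.map (py ∷_) (insertions-All v px pv))

perms-All : {P : ℕ → Set} {xs : List ℕ} → All P xs → All (All P) (perms xs)
perms-All [] = [] ∷ []
perms-All {xs = x ∷ xs} (px ∷ pxs) = concat⁺ (map⁺ (All.map (λ {v} → insertions-All v px) (perms-All pxs)))

∈-perms-All : {P : ℕ → Set} {xs u : List ℕ} → All P xs → u ∈ perms xs → All P u
∈-perms-All pxs = All.lookup (perms-All pxs)

sumBy-insertions-map : (f : ℕ → ℕ) (x : ℕ) (v : List ℕ) (G : List ℕ → ℕ) →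
  sumBy G (insertions (f x) (map f v)) ≡ sumBy (G ∘ map f) (insertions x v)
sumBy-insertions-map f x [] G = refl
sumBy-insertions-map f x (y ∷ v) G = cong (_+_ (G (f x ∷ f y ∷ map f v))) (begin
    sumBy G (map (f y ∷_) (insertions (f x) (map f v)))
  ≡⟨ sumBy-map G (f y ∷_) (insertions (f x) (map f v)) ⟩
    sumBy (G ∘ (f y ∷_)) (insertions (f x) (map f v))
  ≡⟨ sumBy-insertions-map f x v (G ∘ (f y ∷_)) ⟩
    sumBy (G ∘ map f ∘ (y ∷_)) (insertions x v)
  ≡⟨ sumBy-map (G ∘ map f) (y ∷_) (insertions x v) ⟨
    sumBy (G ∘ map f) (map (y ∷_) (insertions x v))
  ∎)
  where open ≡-Reasoning

sumBy-perms-map : (f : ℕ → ℕ) (xs : List ℕ) (G : List ℕ → ℕ) →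
  sumBy G (perms (map f xs)) ≡ sumBy (G ∘ map f) (perms xs)
sumBy-perms-map f [] G = refl
sumBy-perms-map f (x ∷ xs) G = begin
    sumBy G (concatMap (insertions (f x)) (perms (map f xs)))
  ≡⟨ sumBy-concatMap G (insertions (f x)) (perms (map f xs)) ⟩
    sumBy (λ v → sumBy G (insertions (f x) v)) (perms (map f xs))
  ≡⟨ sumBy-perms-map f xs _ ⟩
    sumBy (λ v → sumBy G (insertions (f x) (map f v))) (perms xs)
  ≡⟨ sumBy-cong (perms xs) (λ v → sumBy-insertions-map f x v G) ⟩
    sumBy (λ v → sumBy (G ∘ map f) (insertions x v)) (perms xs)
  ≡⟨ sumBy-concatMap (G ∘ map f) (insertions x) (perms xs) ⟨
    sumBy (G ∘ map f) (concatMap (insertions x) (perms xs))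
  ∎
  where open ≡-Reasoning

withHead : ℕ → (List ℕ → ℕ) → List ℕ → ℕ
withHead k G [] = 0
withHead k G (c ∷ u) = if c ≡ᵇ k then G u else 0

withoutHead : ℕ → (List ℕ → ℕ) → List ℕ → ℕ
withoutHead k F [] = F []
withoutHead k F (c ∷ u) = if c ≡ᵇ k then 0 else F (c ∷ u)

withoutHead+withHead : (k : ℕ) (F : List ℕ → ℕ) (u : List ℕ) →
                       withoutHead k F u + withHead k (F ∘ (k ∷_)) u ≡ F u
withoutHead+withHead k F [] = ℕP.+-identityʳ (F [])
withoutHead+withHead k F (c ∷ u) with c ≡ᵇ k in c≡k
... | true = cong (λ z → F (z ∷ u)) (sym (≡ᵇ-true⇒≡ c≡k))
... | false = ℕP.+-identityʳ (F (c ∷ u))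

withoutHead-∷-cong : (k : ℕ) (F F′ : List ℕ → ℕ) (c : ℕ) (u : List ℕ) →
  (c ≢ k → F (c ∷ u) ≡ F′ (c ∷ u)) → withoutHead k F (c ∷ u) ≡ withoutHead k F′ (c ∷ u)
withoutHead-∷-cong k F F′ c u eq with c ≡ᵇ k in c≡ᵇk
... | true = refl
... | false = eq (≡ᵇ-false⇒≢ c≡ᵇk)

sumBy-withHead-map-∷ : (k y : ℕ) (G : List ℕ → ℕ) (us : List (List ℕ)) →
  sumBy (withHead k G) (map (y ∷_) us) ≡ (if y ≡ᵇ k then sumBy G us else 0)
sumBy-withHead-map-∷ k y G us = trans (sumBy-map (withHead k G) (y ∷_) us) (sumBy-if (y ≡ᵇ k) G us)

sumBy-withHead-perms : (k : ℕ) {xs ys : List ℕ} → All (_≢ k) xs → All (_≢ k) ys →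
  (G : List ℕ → ℕ) → sumBy (withHead k G) (perms (xs ++ k ∷ ys)) ≡ sumBy G (perms (xs ++ ys))
sumBy-withHead-perms k {ys = ys} [] ys≢k G = begin
    sumBy (withHead k G) (concatMap (insertions k) (perms ys))
  ≡⟨ sumBy-concatMap (withHead k G) (insertions k) (perms ys) ⟩
    sumBy (λ v → sumBy (withHead k G) (insertions k v)) (perms ys)
  ≡⟨ sumBy-cong-∈ (perms ys) (insert-k ∘ ∈-perms-All ys≢k) ⟩
    sumBy G (perms ys)
  ∎
  where
  open ≡-Reasoning
  insert-k : {v : List ℕ} → All (_≢ k) v → sumBy (withHead k G) (insertions k v) ≡ G v
  insert-k {[]} [] rewrite ≡ᵇ-refl k = ℕP.+-identityʳ (G [])
  insert-k {y ∷ v} (y≢k ∷ _)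
    rewrite ≡ᵇ-refl k | sumBy-withHead-map-∷ k y G (insertions k v) | ≢⇒≡ᵇ-false y≢k =
    ℕP.+-identityʳ (G (y ∷ v))
sumBy-withHead-perms k {x ∷ xs} {ys} (x≢k ∷ xs≢k) ys≢k G = begin
    sumBy (withHead k G) (concatMap (insertions x) (perms (xs ++ k ∷ ys)))
  ≡⟨ sumBy-concatMap (withHead k G) (insertions x) (perms (xs ++ k ∷ ys)) ⟩
    sumBy (λ v → sumBy (withHead k G) (insertions x v)) (perms (xs ++ k ∷ ys))
  ≡⟨ sumBy-cong (perms (xs ++ k ∷ ys)) insert-x ⟩
    sumBy (withHead k G′) (perms (xs ++ k ∷ ys))
  ≡⟨ sumBy-withHead-perms k xs≢k ys≢k G′ ⟩
    sumBy G′ (perms (xs ++ ys))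
  ≡⟨ sumBy-concatMap G (insertions x) (perms (xs ++ ys)) ⟨
    sumBy G (concatMap (insertions x) (perms (xs ++ ys)))
  ∎
  where
  open ≡-Reasoning
  G′ : List ℕ → ℕ
  G′ v = sumBy G (insertions x v)
  insert-x : (v : List ℕ) → sumBy (withHead k G) (insertions x v) ≡ withHead k G′ v
  insert-x [] rewrite ≢⇒≡ᵇ-false x≢k = refl
  insert-x (y ∷ v) rewrite ≢⇒≡ᵇ-false x≢k = sumBy-withHead-map-∷ k y G (insertions x v)

sumBy-perms-split : (b : ℕ) {xs ys zs : List ℕ} → All (_≢ b) xs → All (_≢ b) ys →
  (ρ : ℕ → ℕ) → map ρ zs ≡ xs ++ ys → (F : List ℕ → ℕ) →
  sumBy F (perms (xs ++ b ∷ ys))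
    ≡ sumBy (withoutHead b F) (perms (xs ++ b ∷ ys)) + sumBy (λ v → F (b ∷ map ρ v)) (perms zs)
sumBy-perms-split b {xs} {ys} {zs} xs≢b ys≢b ρ ρzs F = begin
    sumBy F P
  ≡⟨ sumBy-cong P (λ u → sym (withoutHead+withHead b F u)) ⟩
    sumBy (λ u → withoutHead b F u + withHead b (F ∘ (b ∷_)) u) P
  ≡⟨ sumBy-+ (withoutHead b F) _ P ⟩
    sumBy (withoutHead b F) P + sumBy (withHead b (F ∘ (b ∷_))) P
  ≡⟨ cong (_+_ (sumBy (withoutHead b F) P)) (begin
      sumBy (withHead b (F ∘ (b ∷_))) P          ≡⟨ sumBy-withHead-perms b xs≢b ys≢b _ ⟩
      sumBy (F ∘ (b ∷_)) (perms (xs ++ ys))      ≡⟨ cong (sumBy (F ∘ (b ∷_)) ∘ perms) ρzs ⟨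
      sumBy (F ∘ (b ∷_)) (perms (map ρ zs))      ≡⟨ sumBy-perms-map ρ zs _ ⟩
      sumBy (λ v → F (b ∷ map ρ v)) (perms zs)   ∎) ⟩
    sumBy (withoutHead b F) P + sumBy (λ v → F (b ∷ map ρ v)) (perms zs)
  ∎
  where
  open ≡-Reasoning
  P = perms (xs ++ b ∷ ys)

sumBy-perms-exchange : (b : ℕ) {xs ys zs ws : List ℕ} → All (_≢ b) xs → All (_≢ b) ys →
  (τ ρ : ℕ → ℕ) → map τ (xs ++ b ∷ ys) ≡ ws → map ρ zs ≡ xs ++ ys →
  (F F′ G : List ℕ → ℕ) →
  (∀ {u} → u ∈ perms (xs ++ b ∷ ys) → withoutHead b F u ≡ withoutHead b (F′ ∘ map τ) u) →
  (∀ {v} → v ∈ perms zs → F (b ∷ map ρ v) ≡ F′ (map τ (b ∷ map ρ v)) + G v) →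
  sumBy F (perms (xs ++ b ∷ ys)) ≡ sumBy F′ (perms ws) + sumBy G (perms zs)
sumBy-perms-exchange b {xs} {ys} {zs} {ws} xs≢b ys≢b τ ρ τxs ρzs F F′ G off-head at-head = begin
    sumBy F P
  ≡⟨ sumBy-perms-split b xs≢b ys≢b ρ ρzs F ⟩
    sumBy (withoutHead b F) P + sumBy (λ v → F (b ∷ map ρ v)) Q
  ≡⟨ cong₂ _+_ (sumBy-cong-∈ P off-head) (sumBy-cong-∈ Q at-head) ⟩
    sumBy (withoutHead b F″) P + sumBy (λ v → F″ (b ∷ map ρ v) + G v) Q
  ≡⟨ cong (_+_ (sumBy (withoutHead b F″) P)) (sumBy-+ (λ v → F″ (b ∷ map ρ v)) G Q) ⟩
    sumBy (withoutHead b F″) P + (sumBy (λ v → F″ (b ∷ map ρ v)) Q + sumBy G Q)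
  ≡⟨ ℕP.+-assoc (sumBy (withoutHead b F″) P) _ _ ⟨
    sumBy (withoutHead b F″) P + sumBy (λ v → F″ (b ∷ map ρ v)) Q + sumBy G Q
  ≡⟨ cong (_+ sumBy G Q) (sumBy-perms-split b xs≢b ys≢b ρ ρzs F″) ⟨
    sumBy F″ P + sumBy G Q
  ≡⟨ cong (_+ sumBy G Q) (sumBy-perms-map τ (xs ++ b ∷ ys) F′) ⟨
    sumBy F′ (perms (map τ (xs ++ b ∷ ys))) + sumBy G Q
  ≡⟨ cong (λ l → sumBy F′ (perms l) + sumBy G Q) τxs ⟩
    sumBy F′ (perms ws) + sumBy G Q
  ∎
  where
  open ≡-Reasoning
  P = perms (xs ++ b ∷ ys)
  Q = perms zs
  F″ = F′ ∘ map τ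

PreservesOrderOn : (ℕ → Set) → (ℕ → ℕ) → Set
PreservesOrderOn P f = ∀ x y → P x → P y → (f x <ᵇ f y) ≡ (x <ᵇ y)

<ᵇ-sucˡ : ∀ {k y} → y ≢ suc k → (k <ᵇ y) ≡ (suc k <ᵇ y)
<ᵇ-sucˡ {k} y≢sk = <ᵇ-cong-⇔ (λ k<y → ℕP.≤∧≢⇒< k<y (y≢sk ∘ sym)) (ℕP.<-trans (ℕP.n<1+n k))

<ᵇ-sucʳ : ∀ {x k} → x ≢ k → (x <ᵇ k) ≡ (x <ᵇ suc k)
<ᵇ-sucʳ x≢k = <ᵇ-cong-⇔ ℕP.m<n⇒m<1+n (λ x<sk → ℕP.≤∧≢⇒< (ℕP.m<1+n⇒m≤n x<sk) x≢k)

swap : ℕ → ℕ → ℕ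
swap k x = if x ≡ᵇ k then suc k else if x ≡ᵇ suc k then k else x

swap-k : ∀ k → swap k k ≡ suc k
swap-k k rewrite ≡ᵇ-refl k = refl

swap-suc : ∀ k → swap k (suc k) ≡ k
swap-suc k rewrite ≢⇒≡ᵇ-false {suc k} {k} ℕP.1+n≢n | ≡ᵇ-refl k = refl

swap-other : ∀ {k x} → x ≢ k → x ≢ suc k → swap k x ≡ x
swap-other x≢k x≢sk rewrite ≢⇒≡ᵇ-false x≢k | ≢⇒≡ᵇ-false x≢sk = refl

swap-preserves-order-≢ : ∀ k → PreservesOrderOn (_≢ k) (swap k)
swap-preserves-order-≢ k x y x≢k y≢k with x ℕP.≟ suc k | y ℕP.≟ suc k
... | yes refl | yes refl rewrite swap-suc k = refl
... | yes refl | no y≢sk rewrite swap-suc k | swap-other y≢k y≢sk = <ᵇ-sucˡ y≢sk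
... | no x≢sk  | yes refl rewrite swap-suc k | swap-other x≢k x≢sk = <ᵇ-sucʳ x≢k
... | no x≢sk  | no y≢sk rewrite swap-other x≢k x≢sk | swap-other y≢k y≢sk = refl

swap-preserves-order-≢suc : ∀ k → PreservesOrderOn (_≢ suc k) (swap k)
swap-preserves-order-≢suc k x y x≢sk y≢sk with x ℕP.≟ k | y ℕP.≟ k
... | yes refl | yes refl rewrite swap-k k = refl
... | yes refl | no y≢k rewrite swap-k k | swap-other y≢k y≢sk = sym (<ᵇ-sucˡ y≢sk)
... | no x≢k   | yes refl rewrite swap-k k | swap-other x≢k x≢sk = sym (<ᵇ-sucʳ x≢k)
... | no x≢k   | no y≢k rewrite swap-other x≢k x≢sk | swap-other y≢k y≢sk = refl

shiftAbove : ℕ → ℕ → ℕ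
shiftAbove k x = if k <ᵇ x then suc x else x

shiftAbove-≤ : ∀ {k x} → x ≤ k → shiftAbove k x ≡ x
shiftAbove-≤ x≤k rewrite ≮⇒<ᵇ-false (ℕP.≤⇒≯ x≤k) = refl

shiftAbove-> : ∀ {k x} → k < x → shiftAbove k x ≡ suc x
shiftAbove-> k<x rewrite <⇒<ᵇ-true k<x = refl

shiftAbove-preserves-order : ∀ k → PreservesOrderOn (λ _ → ⊤) (shiftAbove k)
shiftAbove-preserves-order k x y _ _ with k <ᵇ x in k<x | k <ᵇ y in k<y
... | true  | true  = refl
... | false | false = refl
... | true  | false = trans (≮⇒<ᵇ-false (x≮y ∘ ℕP.<-trans (ℕP.n<1+n x))) (sym (≮⇒<ᵇ-false x≮y))
  where
  x≮y : x ≮ y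
  x≮y x<y = <ᵇ-false⇒≮ k<y (ℕP.<-trans (<ᵇ-true⇒< k<x) x<y)
... | false | true  = trans (<⇒<ᵇ-true (ℕP.m<n⇒m<1+n x<y)) (sym (<⇒<ᵇ-true x<y))
  where
  x<y : x < y
  x<y = ℕP.≤-<-trans (ℕP.≮⇒≥ (<ᵇ-false⇒≮ k<x)) (<ᵇ-true⇒< k<y)

swap-shiftAbove : ∀ {k z} → z ≢ k → swap k (shiftAbove k z) ≡ shiftAbove k z
swap-shiftAbove {k} {z} z≢k with k <ᵇ z in k<z
... | true  = swap-other (λ eq → ℕP.<-irrefl (sym eq) (ℕP.<-trans (<ᵇ-true⇒< k<z) (ℕP.n<1+n z)))
                         (z≢k ∘ ℕP.suc-injective)
... | false = swap-other z≢k (λ eq → <ᵇ-false⇒≮ k<z (subst (k <_) (sym eq) (ℕP.n<1+n k)))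

interval : ℕ → ℕ → List ℕ
interval a zero = []
interval a (suc m) = suc a ∷ interval (suc a) m

range1≡interval : ∀ n → range1 n ≡ interval 0 n
range1≡interval n = trans (ListP.map-applyUpTo id suc n) (go 0 n suc (λ _ → refl))
  where
  go : ∀ a m (f : ℕ → ℕ) → (∀ i → f i ≡ suc (a + i)) → applyUpTo f m ≡ interval a m
  go a zero f eq = refl
  go a (suc m) f eq = cong₂ _∷_ (trans (eq 0) (cong suc (ℕP.+-identityʳ a)))
                              (go (suc a) m (f ∘ suc) (λ i → trans (eq (suc i)) (cong suc (ℕP.+-suc a i))))

interval-++ : ∀ a m l → interval a (m + l) ≡ interval a m ++ interval (a + m) l
interval-++ a zero l = cong (λ b → interval b l) (sym (ℕP.+-identityʳ a))
interval-++ a (suc m) l = cong (suc a ∷_) (trans (interval-++ (suc a) m l)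
  (cong (λ b → interval (suc a) m ++ interval b l) (sym (ℕP.+-suc a m))))

interval-> : ∀ a m → All (a <_) (interval a m)
interval-> a zero = []
interval-> a (suc m) = ℕP.n<1+n a ∷ All.map (ℕP.<-trans (ℕP.n<1+n a)) (interval-> (suc a) m)

interval-≤ : ∀ a m → All (_≤ a + m) (interval a m)
interval-≤ a zero = []
interval-≤ a (suc m) = subst (suc a ≤_) (sym (ℕP.+-suc a m)) (s≤s (ℕP.m≤m+n a m))
  ∷ All.map (λ {z} → subst (z ≤_) (sym (ℕP.+-suc a m))) (interval-≤ (suc a) m)

map-suc-interval : ∀ a m → map suc (interval a m) ≡ interval (suc a) m
map-suc-interval a zero = refl
map-suc-interval a (suc m) = cong (suc (suc a) ∷_) (map-suc-interval (suc a) m)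

-- Admissible signings

belowHead : ℕ → List ℕ → Bool
belowHead a [] = false
belowHead a (b ∷ _) = a <ᵇ b

-- σ is admissible after an entry of absolute value p: an entry may be negative
-- only if the entry before it is a valley; `free` allows the first entry of σ to be negative.
admissibleAfter : Bool → ℕ → List ℤ → Bool
admissibleAfter free p [] = true
admissibleAfter free p (x ∷ s) =
  (not (isNeg x) ∨ free) ∧ admissibleAfter ((∣ x ∣ <ᵇ p) ∧ belowHead ∣ x ∣ (absW s)) ∣ x ∣ s

signAllowedAt : Bool → ℕ → List ℤ → ℕ → Bool
signAllowedAt free p σ zero = true
signAllowedAt free p σ (suc zero) = not (isNeg (nth (+ 0) σ 1)) ∨ free
signAllowedAt free p σ (suc (suc j)) =
  not (isNeg (nth (+ 0) σ (suc (suc j)))) ∨ isValley (p ∷ absW σ) (suc (suc j))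

allᵇ-map : (h : B → Bool) (g : A → B) (xs : List A) → allᵇ h (map g xs) ≡ allᵇ (h ∘ g) xs
allᵇ-map h g [] = refl
allᵇ-map h g (x ∷ xs) = cong (h (g x) ∧_) (allᵇ-map h g xs)

allᵇ-cong : {h h′ : A → Bool} (xs : List A) → (∀ x → h x ≡ h′ x) → allᵇ h xs ≡ allᵇ h′ xs
allᵇ-cong [] eq = refl
allᵇ-cong (x ∷ xs) eq = cong₂ _∧_ (eq x) (allᵇ-cong xs eq)

allᵇ-range1-suc : (h : ℕ → Bool) (m : ℕ) → allᵇ h (range1 (suc m)) ≡ h 1 ∧ allᵇ (h ∘ suc) (range1 m)
allᵇ-range1-suc h m = begin
    allᵇ h (range1 (suc m))
  ≡⟨ cong (allᵇ h) (range1≡interval (suc m)) ⟩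
    h 1 ∧ allᵇ h (interval 1 m)
  ≡⟨ cong (λ l → h 1 ∧ allᵇ h l) (map-suc-interval 0 m) ⟨
    h 1 ∧ allᵇ h (map suc (interval 0 m))
  ≡⟨ cong (h 1 ∧_) (allᵇ-map h suc (interval 0 m)) ⟩
    h 1 ∧ allᵇ (h ∘ suc) (interval 0 m)
  ≡⟨ cong (λ l → h 1 ∧ allᵇ (h ∘ suc) l) (range1≡interval m) ⟨
    h 1 ∧ allᵇ (h ∘ suc) (range1 m)
  ∎
  where open ≡-Reasoning

allᵇ-range1-cong : {h h′ : ℕ → Bool} (m : ℕ) → (∀ i → h (suc i) ≡ h′ (suc i)) →
                   allᵇ h (range1 m) ≡ allᵇ h′ (range1 m)
allᵇ-range1-cong {h} {h′} m eq =
  trans (allᵇ-map h suc (upTo m)) (trans (allᵇ-cong (upTo m) eq) (sym (allᵇ-map h′ suc (upTo m))))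

signAllowedAt-∷ : (free : Bool) (p : ℕ) (x : ℤ) (s : List ℤ) (i : ℕ) →
  signAllowedAt free p (x ∷ s) (suc (suc i))
    ≡ signAllowedAt ((∣ x ∣ <ᵇ p) ∧ belowHead ∣ x ∣ (absW s)) ∣ x ∣ s (suc i)
signAllowedAt-∷ free p x [] zero = refl
signAllowedAt-∷ free p x (_ ∷ _) zero = refl
signAllowedAt-∷ free p x s (suc j) = refl

allᵇ-signAllowedAt : (free : Bool) (p : ℕ) (σ : List ℤ) →
  allᵇ (signAllowedAt free p σ) (range1 (length σ)) ≡ admissibleAfter free p σ
allᵇ-signAllowedAt free p [] = refl
allᵇ-signAllowedAt free p (x ∷ s) =
  trans (allᵇ-range1-suc (signAllowedAt free p (x ∷ s)) (length s))
        (cong ((not (isNeg x) ∨ free) ∧_)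
              (trans (allᵇ-range1-cong (length s) (signAllowedAt-∷ free p x s))
                     (allᵇ-signAllowedAt _ ∣ x ∣ s)))

inVSB-∷ : (x : ℤ) (s : List ℤ) →
          inVSB (x ∷ s) ≡ not (isNeg x) ∧ admissibleAfter (belowHead ∣ x ∣ (absW s)) ∣ x ∣ s
inVSB-∷ x s =
  trans (allᵇ-range1-suc _ (length s))
        (cong₂ _∧_ (∨-identityʳ (not (isNeg x)))
                   (trans (allᵇ-range1-cong (length s) (step s)) (allᵇ-signAllowedAt _ ∣ x ∣ s)))
  where
  step : (t : List ℤ) (i : ℕ) →
    not (isNeg (nth (+ 0) t (suc i))) ∨ ((2 ≤ᵇ suc (suc i)) ∧ isValley (∣ x ∣ ∷ absW t) (suc i))
      ≡ signAllowedAt (belowHead ∣ x ∣ (absW t)) ∣ x ∣ t (suc i)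
  step [] zero = refl
  step (_ ∷ _) zero = refl
  step t (suc j) = refl

inVSD-∷ : (x : ℤ) (s : List ℤ) → inVSD (x ∷ s) ≡
  isNeg x ∧ ((not (2 ≤ᵇ length (x ∷ s)) ∨ (isPos (nth (+ 0) s 1) ∧ (∣ nth (+ 0) s 1 ∣ <ᵇ ∣ x ∣)))
             ∧ admissibleAfter true ∣ x ∣ s)
inVSD-∷ x s =
  cong (λ b → isNeg x ∧ (second ∧ b))
       (trans (allᵇ-range1-suc laterEntry (length s))
              (trans (allᵇ-range1-cong (length s) step) (allᵇ-signAllowedAt true ∣ x ∣ s)))
  where
  second : Bool
  second = not (2 ≤ᵇ length (x ∷ s)) ∨ (isPos (nth (+ 0) s 1) ∧ (∣ nth (+ 0) s 1 ∣ <ᵇ ∣ x ∣))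
  laterEntry : ℕ → Bool
  laterEntry i = not (3 ≤ᵇ i) ∨ not (isNeg (nth (+ 0) (x ∷ s) i)) ∨ isValley (absW (x ∷ s)) (i ∸ 1)
  step : ∀ i → laterEntry (suc (suc i)) ≡ signAllowedAt true ∣ x ∣ s (suc i)
  step zero = sym (∨-zeroʳ _)
  step (suc j) = refl

-- The number of signings s of u admissible after (free, p) such that h (neg s); the test h
-- selects one coefficient of the Laurent polynomial.
signCount : Bool → ℕ → List ℕ → (ℕ → Bool) → ℕ
signCount free p [] h = if h 0 then 1 else 0
signCount free p (b ∷ u) h =
  signCount ((b <ᵇ p) ∧ belowHead b u) b u h
  + (if free then signCount ((b <ᵇ p) ∧ belowHead b u) b u (h ∘ suc) else 0)

signCount-cong : (free : Bool) (p : ℕ) (u : List ℕ) {h h′ : ℕ → Bool} → (∀ j → h j ≡ h′ j) →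
  signCount free p u h ≡ signCount free p u h′
signCount-cong free p [] eq rewrite eq 0 = refl
signCount-cong free p (b ∷ u) eq =
  cong₂ _+_ (signCount-cong _ b u eq) (cong (if free then_else 0) (signCount-cong _ b u (eq ∘ suc)))

belowHead-relabel : {P : ℕ → Set} (f : ℕ → ℕ) → PreservesOrderOn P f →
  ∀ {b c w} → f b ≡ c → P b → All P w → belowHead c (map f w) ≡ belowHead b w
belowHead-relabel f f-mono refl pb [] = refl
belowHead-relabel f f-mono {b} {w = c ∷ _} refl pb (pc ∷ _) = f-mono b c pb pc

signCount-relabel : {P : ℕ → Set} (f : ℕ → ℕ) → PreservesOrderOn P f →
  ∀ free {p q w} h → f p ≡ q → P p → All P w → signCount free q (map f w) h ≡ signCount free p w h
signCount-relabel f f-mono free h refl pp [] = refl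
signCount-relabel f f-mono free {p} {w = b ∷ w} h refl pp (pb ∷ pw) =
  cong₂ _+_ (relabel h) (cong (if free then_else 0) (relabel (h ∘ suc)))
  where
  valley≡ : (f b <ᵇ f p) ∧ belowHead (f b) (map f w) ≡ (b <ᵇ p) ∧ belowHead b w
  valley≡ = cong₂ _∧_ (f-mono b p pb pp) (belowHead-relabel f f-mono refl pb pw)
  relabel : ∀ h′ → signCount ((f b <ᵇ f p) ∧ belowHead (f b) (map f w)) (f b) (map f w) h′
                 ≡ signCount ((b <ᵇ p) ∧ belowHead b w) b w h′
  relabel h′ = trans (cong (λ g → signCount g (f b) (map f w) h′) valley≡)
                     (signCount-relabel f f-mono _ h′ refl pb pw)

-- The weights of the words +k, u (type B) and -k, u (type D).
countB : ℕ → (ℕ → Bool) → List ℕ → ℕ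
countB k h u = signCount (belowHead k u) k u h

countD : ℕ → (ℕ → Bool) → List ℕ → ℕ
countD k h [] = if h 1 then 1 else 0
countD k h (b ∷ u) = if b <ᵇ k then countB b (h ∘ suc) u else 0

signings-absW : ∀ u → All (λ s → absW s ≡ u) (signings u)
signings-absW [] = refl ∷ []
signings-absW (a ∷ u) =
  concat⁺ (map⁺ (All.map (λ eq → cong (a ∷_) eq ∷ cong₂ _∷_ (ℤP.∣-i∣≡∣i∣ (+ a)) eq ∷ [])
                          (signings-absW u)))

count-signings-∷ : (q : List ℤ → Bool) (c : ℕ) (u : List ℕ) → count q (signings (suc c ∷ u))
  ≡ count (q ∘ (+ suc c ∷_)) (signings u) + count (q ∘ (-[1+ c ] ∷_)) (signings u)
count-signings-∷ q c u = begin
    count q (signings (suc c ∷ u))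
  ≡⟨ count-concatMap q _ (signings u) ⟩
    sumBy (λ s → 𝟙[ + suc c ∷ s ] + (𝟙[ -[1+ c ] ∷ s ] + 0)) (signings u)
  ≡⟨ sumBy-cong (signings u) (λ s → cong (_+_ 𝟙[ + suc c ∷ s ]) (ℕP.+-identityʳ _)) ⟩
    sumBy (λ s → 𝟙[ + suc c ∷ s ] + 𝟙[ -[1+ c ] ∷ s ]) (signings u)
  ≡⟨ sumBy-+ _ _ (signings u) ⟩
    sumBy (λ s → 𝟙[ + suc c ∷ s ]) (signings u) + sumBy (λ s → 𝟙[ -[1+ c ] ∷ s ]) (signings u)
  ≡⟨ cong₂ _+_ (count≡sumBy _ (signings u)) (count≡sumBy _ (signings u)) ⟨
    count (q ∘ (+ suc c ∷_)) (signings u) + count (q ∘ (-[1+ c ] ∷_)) (signings u)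
  ∎
  where
  open ≡-Reasoning
  𝟙[_] : List ℤ → ℕ
  𝟙[ σ ] = if q σ then 1 else 0

count-admissible-signings : (free : Bool) (p : ℕ) {u : List ℕ} → All (0 <_) u → (h : ℕ → Bool) →
  count (λ s → admissibleAfter free p s ∧ h (neg s)) (signings u) ≡ signCount free p u h
count-admissible-signings free p [] h = ℕP.+-identityʳ _
count-admissible-signings free p {suc b ∷ u} (_ ∷ u>0) h =
  trans (count-signings-∷ _ b u) (cong₂ _+_ (tail h) (negative free))
  where
  valley : List ℕ → Bool
  valley w = (suc b <ᵇ p) ∧ belowHead (suc b) w
  tail : ∀ h′ → count (λ s → admissibleAfter (valley (absW s)) (suc b) s ∧ h′ (neg s)) (signings u)
              ≡ signCount (valley u) (suc b) u h′
  tail h′ = trans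
    (count-cong-local (All.map (λ {s} → cong (λ w → admissibleAfter (valley w) (suc b) s ∧ h′ (neg s)))
                               (signings-absW u)))
    (count-admissible-signings (valley u) (suc b) u>0 h′)
  negative : ∀ free′ →
    count (λ s → (free′ ∧ admissibleAfter (valley (absW s)) (suc b) s) ∧ h (suc (neg s))) (signings u)
      ≡ (if free′ then signCount (valley u) (suc b) u (h ∘ suc) else 0)
  negative true = tail (h ∘ suc)
  negative false = count-const-false _ (signings u) (λ _ → refl)

count-signings-countB : (a : ℕ) {u : List ℕ} → All (0 <_) u → (h : ℕ → Bool) →
  count (λ s → admissibleAfter (belowHead a (absW s)) a s ∧ h (neg s)) (signings u) ≡ countB a h u
count-signings-countB a {u} u>0 h = trans
  (count-cong-local (All.map (λ {s} → cong (λ w → admissibleAfter (belowHead a w) a s ∧ h (neg s)))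
                             (signings-absW u)))
  (count-admissible-signings (belowHead a u) a u>0 h)

countB-relabel : {P : ℕ → Set} (f : ℕ → ℕ) → PreservesOrderOn P f →
  ∀ {b w} h → f b ≡ b → P b → All P w → countB b h (map f w) ≡ countB b h w
countB-relabel f f-mono {b} {w} h fb≡b pb pw =
  trans (cong (λ g → signCount g b (map f w) h) (belowHead-relabel f f-mono fb≡b pb pw))
        (signCount-relabel f f-mono _ h fb≡b pb pw)

countD-cong : ∀ k {h h′} u → (∀ j → h j ≡ h′ j) → countD k h u ≡ countD k h′ u
countD-cong k [] eq = cong (λ b → if b then 1 else 0) (eq 1)
countD-cong k (b ∷ u) eq = cong (if b <ᵇ k then_else 0) (signCount-cong _ b u (eq ∘ suc))

-- VS^(B) and VS^(D) as sums over the permutations |σ|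

exponent : ℕ → ℕ → ℤ
exponent n j = + suc n ℤ.- + (2 * j)

expoIs : ℕ → ℤ → ℕ → Bool
expoIs n e j = ⌊ exponent n j ℤ.≟ e ⌋

vsbFilter : ℕ → ℕ → ℤ → List ℤ → Bool
vsbFilter n k e σ = inVSB σ ∧ (1 ≤ᵇ length σ) ∧ ⌊ nth (+ 0) σ 1 ℤ.≟ + k ⌋ ∧ ⌊ expo n σ ℤ.≟ e ⌋

vsdFilter : ℕ → ℕ → ℤ → List ℤ → Bool
vsdFilter n k e σ = inVSD σ ∧ (1 ≤ᵇ length σ) ∧ ⌊ nth (+ 0) σ 1 ℤ.≟ - (+ k) ⌋ ∧ ⌊ expo n σ ℤ.≟ e ⌋

∧-guard-rearrange : (l b z : Bool) (F : Bool → Bool) → (l ∧ F l) ∧ (b ∧ z) ≡ b ∧ (l ∧ (F true ∧ z))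
∧-guard-rearrange true true z F = refl
∧-guard-rearrange true false z F = ∧-zeroʳ (F true)
∧-guard-rearrange false b z F = sym (∧-zeroʳ b)

if-≡ᵇ-subst : (x k : ℕ) (F : ℕ → ℕ) → (if x ≡ᵇ k then F x else 0) ≡ (if x ≡ᵇ k then F k else 0)
if-≡ᵇ-subst x k F with x ≡ᵇ k in x≡k
... | true = cong F (≡ᵇ-true⇒≡ x≡k)
... | false = refl

count-vsbFilter-signings : (n k : ℕ) (e : ℤ) {w : List ℕ} → All (0 <_) w →
  count (vsbFilter n k e) (signings w) ≡ withHead k (countB k (expoIs n e)) w
count-vsbFilter-signings n k e [] = refl
count-vsbFilter-signings n k e {suc c ∷ u} (_ ∷ u>0) = begin
    count (vsbFilter n k e) (signings (suc c ∷ u))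
  ≡⟨ count-signings-∷ (vsbFilter n k e) c u ⟩
    count (vsbFilter n k e ∘ (+ suc c ∷_)) (signings u) + count (vsbFilter n k e ∘ (-[1+ c ] ∷_)) (signings u)
  ≡⟨ cong₂ _+_ positive negative ⟩
    (if suc c ≡ᵇ k then countB (suc c) h u else 0) + 0
  ≡⟨ ℕP.+-identityʳ _ ⟩
    (if suc c ≡ᵇ k then countB (suc c) h u else 0)
  ≡⟨ if-≡ᵇ-subst (suc c) k (λ k′ → countB k′ h u) ⟩
    withHead k (countB k h) (suc c ∷ u)
  ∎
  where
  open ≡-Reasoning
  h = expoIs n e
  admissible : List ℤ → Bool
  admissible s = admissibleAfter (belowHead (suc c) (absW s)) (suc c) s ∧ h (neg s)
  negative : count (vsbFilter n k e ∘ (-[1+ c ] ∷_)) (signings u) ≡ 0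
  negative = count-const-false _ (signings u) (λ s → ∧-zeroʳ (inVSB (-[1+ c ] ∷ s)))
  positive : count (vsbFilter n k e ∘ (+ suc c ∷_)) (signings u)
           ≡ (if suc c ≡ᵇ k then countB (suc c) h u else 0)
  positive = begin
      count (vsbFilter n k e ∘ (+ suc c ∷_)) (signings u)
    ≡⟨ count-cong-local (All.universal filter≡ (signings u)) ⟩
      count (λ s → (suc c ≡ᵇ k) ∧ admissible s) (signings u)
    ≡⟨ count-∧ˡ (suc c ≡ᵇ k) admissible (signings u) ⟩
      (if suc c ≡ᵇ k then count admissible (signings u) else 0)
    ≡⟨ cong (if suc c ≡ᵇ k then_else 0) (count-signings-countB (suc c) u>0 h) ⟩
      (if suc c ≡ᵇ k then countB (suc c) h u else 0)
    ∎
    where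
    filter≡ : ∀ s → vsbFilter n k e (+ suc c ∷ s) ≡ (suc c ≡ᵇ k) ∧ admissible s
    filter≡ s =
      trans (cong₂ (λ a b → a ∧ (b ∧ h (neg s))) (inVSB-∷ (+ suc c) s) (isYes≗does (+ suc c ℤ.≟ + k)))
            (∧-guard-rearrange true (suc c ≡ᵇ k) (h (neg s))
                               (λ _ → admissibleAfter (belowHead (suc c) (absW s)) (suc c) s))

count-vsdFilter-signings : (n k : ℕ) (e : ℤ) {w : List ℕ} → All (0 <_) w →
  count (vsdFilter n k e) (signings w) ≡ withHead k (countD k (expoIs n e)) w
count-vsdFilter-signings n k e [] = refl
count-vsdFilter-signings n zero e {suc c ∷ u} _ = trans (count-signings-∷ _ c u)
  (cong₂ _+_ (count-const-false _ (signings u) (λ _ → refl))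
             (count-const-false _ (signings u) (λ s → ∧-zeroʳ (inVSD (-[1+ c ] ∷ s)))))
count-vsdFilter-signings n (suc k) e {suc c ∷ []} _ rewrite isYes≗does (-[1+ c ] ℤ.≟ -[1+ k ]) with c ≡ᵇ k
... | true = ℕP.+-identityʳ _
... | false = refl
count-vsdFilter-signings n (suc k) e {suc c ∷ suc b ∷ u} (_ ∷ _ ∷ u>0) = begin
    count (vsdFilter n (suc k) e) (signings (suc c ∷ suc b ∷ u))
  ≡⟨ count-signings-∷ _ c (suc b ∷ u) ⟩
    count (vsdFilter n (suc k) e ∘ (+ suc c ∷_)) (signings (suc b ∷ u))
    + count (vsdFilter n (suc k) e ∘ (-[1+ c ] ∷_)) (signings (suc b ∷ u))
  ≡⟨ cong₂ _+_ (count-const-false _ (signings (suc b ∷ u)) (λ _ → refl)) (count-signings-∷ _ b u) ⟩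
    count (λ s → vsdFilter n (suc k) e (-[1+ c ] ∷ + suc b ∷ s)) (signings u)
    + count (λ s → vsdFilter n (suc k) e (-[1+ c ] ∷ -[1+ b ] ∷ s)) (signings u)
  ≡⟨ cong₂ _+_ second-positive (count-const-false _ (signings u) (λ _ → refl)) ⟩
    (if c ≡ᵇ k then (if b <ᵇ c then countB (suc b) (h ∘ suc) u else 0) else 0) + 0
  ≡⟨ ℕP.+-identityʳ _ ⟩
    (if c ≡ᵇ k then (if b <ᵇ c then countB (suc b) (h ∘ suc) u else 0) else 0)
  ≡⟨ if-≡ᵇ-subst c k (λ k′ → if b <ᵇ k′ then countB (suc b) (h ∘ suc) u else 0) ⟩
    withHead (suc k) (countD (suc k) h) (suc c ∷ suc b ∷ u)
  ∎
  where
  open ≡-Reasoning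
  h = expoIs n e
  admissible : List ℤ → Bool
  admissible s = admissibleAfter (belowHead (suc b) (absW s)) (suc b) s ∧ h (suc (neg s))
  filter≡ : ∀ s → vsdFilter n (suc k) e (-[1+ c ] ∷ + suc b ∷ s)
                  ≡ (c ≡ᵇ k) ∧ ((b <ᵇ c) ∧ admissible s)
  filter≡ s =
    trans (cong₂ (λ a d → a ∧ (d ∧ h (suc (neg s)))) (inVSD-∷ -[1+ c ] (+ suc b ∷ s))
                 (isYes≗does (-[1+ c ] ℤ.≟ -[1+ k ])))
          (∧-guard-rearrange (b <ᵇ c) (c ≡ᵇ k) (h (suc (neg s)))
                             (λ l → admissibleAfter (l ∧ belowHead (suc b) (absW s)) (suc b) s))
  second-positive : count (λ s → vsdFilter n (suc k) e (-[1+ c ] ∷ + suc b ∷ s)) (signings u)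
                  ≡ (if c ≡ᵇ k then (if b <ᵇ c then countB (suc b) (h ∘ suc) u else 0) else 0)
  second-positive = begin
      count (λ s → vsdFilter n (suc k) e (-[1+ c ] ∷ + suc b ∷ s)) (signings u)
    ≡⟨ count-cong-local (All.universal filter≡ (signings u)) ⟩
      count (λ s → (c ≡ᵇ k) ∧ ((b <ᵇ c) ∧ admissible s)) (signings u)
    ≡⟨ count-∧ˡ (c ≡ᵇ k) _ (signings u) ⟩
      (if c ≡ᵇ k then count (λ s → (b <ᵇ c) ∧ admissible s) (signings u) else 0)
    ≡⟨ cong (if c ≡ᵇ k then_else 0) (count-∧ˡ (b <ᵇ c) admissible (signings u)) ⟩
      (if c ≡ᵇ k then (if b <ᵇ c then count admissible (signings u) else 0) else 0)
    ≡⟨ cong (λ z → if c ≡ᵇ k then (if b <ᵇ c then z else 0) else 0)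
            (count-signings-countB (suc b) u>0 (h ∘ suc)) ⟩
      (if c ≡ᵇ k then (if b <ᵇ c then countB (suc b) (h ∘ suc) u else 0) else 0)
    ∎

range1-positive : ∀ n → All (0 <_) (range1 n)
range1-positive n = subst (All (0 <_)) (sym (range1≡interval n)) (interval-> 0 n)

VSB-fibres : ∀ n k e → VSB n k e ≡ sumBy (withHead k (countB k (expoIs n e))) (perms (range1 n))
VSB-fibres n k e = trans (count-concatMap (vsbFilter n k e) signings (perms (range1 n)))
  (sumBy-cong-∈ (perms (range1 n)) (count-vsbFilter-signings n k e ∘ ∈-perms-All (range1-positive n)))

VSD-fibres : ∀ n k e → VSD n k e ≡ sumBy (withHead k (countD k (expoIs n e))) (perms (range1 n))
VSD-fibres n k e = trans (count-concatMap (vsdFilter n k e) signings (perms (range1 n)))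
  (sumBy-cong-∈ (perms (range1 n)) (count-vsdFilter-signings n k e ∘ ∈-perms-All (range1-positive n)))

expoIs-shift : ∀ {n j n′ j′} (c e : ℤ) → exponent n′ j′ ≡ exponent n j ℤ.+ c →
               expoIs n e j ≡ expoIs n′ (e ℤ.+ c) j′
expoIs-shift {n} {j} {n′} {j′} c e eq = begin
    ⌊ exponent n j ℤ.≟ e ⌋
  ≡⟨ isYes≗does (exponent n j ℤ.≟ e) ⟩
    does (exponent n j ℤ.≟ e)
  ≡⟨ does-⇔ (mk⇔ (cong (ℤ._+ c)) cancel) (exponent n j ℤ.≟ e) (exponent n j ℤ.+ c ℤ.≟ e ℤ.+ c) ⟩
    does (exponent n j ℤ.+ c ℤ.≟ e ℤ.+ c)
  ≡⟨ isYes≗does (exponent n j ℤ.+ c ℤ.≟ e ℤ.+ c) ⟨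
    ⌊ exponent n j ℤ.+ c ℤ.≟ e ℤ.+ c ⌋
  ≡⟨ cong (λ x → ⌊ x ℤ.≟ e ℤ.+ c ⌋) eq ⟨
    ⌊ exponent n′ j′ ℤ.≟ e ℤ.+ c ⌋
  ∎
  where
  open ≡-Reasoning
  i+c-c≡i : ∀ x c → x ℤ.+ c ℤ.+ - c ≡ x
  i+c-c≡i = solve-∀
  cancel : ∀ {x y} → x ℤ.+ c ≡ y ℤ.+ c → x ≡ y
  cancel {x} {y} eq = trans (sym (i+c-c≡i x c)) (trans (cong (ℤ._+ - c) eq) (i+c-c≡i y c))

exponent≡ : ∀ n j → exponent n j ≡ + 1 ℤ.+ + n ℤ.- + 2 ℤ.* + j
exponent≡ n j = cong (ℤ._-_ (+ suc n)) (ℤP.pos-* 2 j)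

exponent-sucʳ : ∀ n j → exponent n (suc j) ≡ exponent n j ℤ.+ - (+ 2)
exponent-sucʳ n j =
  trans (exponent≡ n (suc j)) (trans (poly (+ n) (+ j)) (cong (ℤ._+ - (+ 2)) (sym (exponent≡ n j))))
  where
  poly : ∀ a b → + 1 ℤ.+ a ℤ.- + 2 ℤ.* (+ 1 ℤ.+ b) ≡ (+ 1 ℤ.+ a ℤ.- + 2 ℤ.* b) ℤ.+ - (+ 2)
  poly = solve-∀

exponent-sucˡ : ∀ n j → exponent n j ≡ exponent (suc n) j ℤ.+ - (+ 1)
exponent-sucˡ n j =
  trans (exponent≡ n j) (trans (poly (+ n) (+ j)) (cong (ℤ._+ - (+ 1)) (sym (exponent≡ (suc n) j))))
  where
  poly : ∀ a b → + 1 ℤ.+ a ℤ.- + 2 ℤ.* b ≡ (+ 1 ℤ.+ (+ 1 ℤ.+ a) ℤ.- + 2 ℤ.* b) ℤ.+ - (+ 1)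
  poly = solve-∀

exponent-sucˡʳ : ∀ n j → exponent n j ≡ exponent (suc n) (suc j) ℤ.+ + 1
exponent-sucˡʳ n j =
  trans (exponent≡ n j) (trans (poly (+ n) (+ j)) (cong (ℤ._+ + 1) (sym (exponent≡ (suc n) (suc j)))))
  where
  poly : ∀ a b → + 1 ℤ.+ a ℤ.- + 2 ℤ.* b ≡ (+ 1 ℤ.+ (+ 1 ℤ.+ a) ℤ.- + 2 ℤ.* (+ 1 ℤ.+ b)) ℤ.+ + 1
  poly = solve-∀

expoIs-sucʳ : ∀ n e j → expoIs n e j ≡ expoIs n (e ℤ.+ - (+ 2)) (suc j)
expoIs-sucʳ n e j = expoIs-shift {n} {j} {n} {suc j} (- (+ 2)) e (exponent-sucʳ n j)

expoIs-sucˡ : ∀ n e j → expoIs (suc n) e j ≡ expoIs n (e ℤ.+ - (+ 1)) j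
expoIs-sucˡ n e j = expoIs-shift {suc n} {j} {n} {j} (- (+ 1)) e (exponent-sucˡ n j)

expoIs-sucˡʳ : ∀ n e j → expoIs (suc n) e (suc j) ≡ expoIs n (e ℤ.+ + 1) j
expoIs-sucˡʳ n e j = expoIs-shift {suc n} {suc j} {n} {j} (+ 1) e (exponent-sucˡʳ n j)

-- Exchanging the values k and k+1

countB-swap-∷ : ∀ k h {b u} → b ≢ k → b ≢ suc k → All (_≢ k) u →
  countB k h (b ∷ u) ≡ countB (suc k) h (map (swap k) (b ∷ u))
countB-swap-∷ k h {b} {u} b≢k b≢sk u≢k rewrite swap-other b≢k b≢sk =
  cong₂ _+_ (tail h) (cong₂ (λ c z → if c then z else 0) (<ᵇ-sucˡ b≢sk) (tail (h ∘ suc)))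
  where
  τ-mono = swap-preserves-order-≢ k
  τb≡b = swap-other b≢k b≢sk
  valley≡ : (b <ᵇ k) ∧ belowHead b u ≡ (b <ᵇ suc k) ∧ belowHead b (map (swap k) u)
  valley≡ = cong₂ _∧_ (<ᵇ-sucʳ b≢k) (sym (belowHead-relabel (swap k) τ-mono τb≡b b≢k u≢k))
  tail : ∀ h′ → signCount ((b <ᵇ k) ∧ belowHead b u) b u h′
              ≡ signCount ((b <ᵇ suc k) ∧ belowHead b (map (swap k) u)) b (map (swap k) u) h′
  tail h′ = trans (cong (λ g → signCount g b u h′) valley≡)
                  (sym (signCount-relabel (swap k) τ-mono _ h′ τb≡b b≢k u≢k))

countB-swap-off-head : ∀ k h {u} → All (_≢ k) u →
  withoutHead (suc k) (countB k h) u ≡ withoutHead (suc k) (countB (suc k) h ∘ map (swap k)) u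
countB-swap-off-head k h [] = refl
countB-swap-off-head k h {b ∷ u} (b≢k ∷ u≢k) =
  withoutHead-∷-cong (suc k) (countB k h) (countB (suc k) h ∘ map (swap k)) b u
                     (λ b≢sk → countB-swap-∷ k h b≢k b≢sk u≢k)

map-swap-shiftAbove : ∀ {k v} → All (_≢ k) v → map (swap k) (map (shiftAbove k) v) ≡ map (shiftAbove k) v
map-swap-shiftAbove [] = refl
map-swap-shiftAbove (z≢k ∷ v≢k) = cong₂ _∷_ (swap-shiftAbove z≢k) (map-swap-shiftAbove v≢k)

signCount-after-suc : ∀ k h {v} → All (_≢ k) v →
  signCount false (suc k) (map (shiftAbove k) v) h + signCount false (suc k) (map (shiftAbove k) v) (h ∘ suc)
    ≡ countB k h (map (shiftAbove k) v) + countD k h v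
signCount-after-suc k h [] = refl
signCount-after-suc k h {b ∷ v} (b≢k ∷ v≢k) with ℕP.<-cmp b k
... | tri< b<k _ _
  rewrite shiftAbove-≤ (ℕP.<⇒≤ b<k) | <⇒<ᵇ-true b<k | ≮⇒<ᵇ-false (ℕP.<⇒≯ b<k)
        | <⇒<ᵇ-true (ℕP.m<n⇒m<1+n b<k) =
  cong (_+_ _) (trans (ℕP.+-identityʳ _)
                     (countB-relabel (shiftAbove k) (shiftAbove-preserves-order k) (h ∘ suc)
                                     (shiftAbove-≤ (ℕP.<⇒≤ b<k)) tt (All.universal (λ _ → tt) v)))
... | tri≈ _ b≡k _ = ⊥-elim (b≢k b≡k)
... | tri> _ _ k<b
  rewrite shiftAbove-> k<b | <⇒<ᵇ-true (ℕP.m<n⇒m<1+n k<b) | ≮⇒<ᵇ-false (ℕP.<⇒≯ k<b)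
        | ≮⇒<ᵇ-false (ℕP.<⇒≯ (ℕP.<-trans k<b (ℕP.n<1+n b))) =
  trans (cong₂ _+_ (ℕP.+-identityʳ (positive h)) (ℕP.+-identityʳ (positive (h ∘ suc))))
        (sym (ℕP.+-identityʳ (positive h + positive (h ∘ suc))))
  where
  positive : (ℕ → Bool) → ℕ
  positive = signCount false (suc b) (map (shiftAbove k) v)

-- The signings of k, k+1, w with k+1 positive match those of k+1, k, w with w₁ positive; those
-- with k+1 negative match those of k+1, k, w with w₁ negative if w₁ > k, and those of -k, v if w₁ < k.
countB-swap-at-head : ∀ k h {v} → All (_≢ k) v →
  countB k h (suc k ∷ map (shiftAbove k) v)
    ≡ countB (suc k) h (map (swap k) (suc k ∷ map (shiftAbove k) v)) + countD k h v
countB-swap-at-head k h {v} v≢k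
  rewrite swap-suc k | map-swap-shiftAbove v≢k
        | <⇒<ᵇ-true (ℕP.n<1+n k) | ≮⇒<ᵇ-false (ℕP.<⇒≯ (ℕP.n<1+n k)) =
  trans (signCount-after-suc k h v≢k) (cong (_+ countD k h v) (sym (ℕP.+-identityʳ _)))

countD-swap-∷ : ∀ k h {b u} → b ≢ k → b ≢ suc k → All (_≢ suc k) u →
  countD (suc k) h (b ∷ u) ≡ countD k h (map (swap k) (b ∷ u))
countD-swap-∷ k h {b} {u} b≢k b≢sk u≢sk rewrite swap-other b≢k b≢sk =
  cong₂ (λ c z → if c then z else 0) (sym (<ᵇ-sucʳ b≢k))
        (sym (countB-relabel (swap k) (swap-preserves-order-≢suc k) (h ∘ suc)
                             (swap-other b≢k b≢sk) b≢sk u≢sk))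

countD-swap-off-head : ∀ k h {u} → All (_≢ suc k) u →
  withoutHead k (countD (suc k) h) u ≡ withoutHead k (countD k h ∘ map (swap k)) u
countD-swap-off-head k h [] = refl
countD-swap-off-head k h {b ∷ u} (b≢sk ∷ u≢sk) =
  withoutHead-∷-cong k (countD (suc k) h) (countD k h ∘ map (swap k)) b u
                     (λ b≢k → countD-swap-∷ k h b≢k b≢sk u≢sk)

countD-swap-at-head : ∀ k h v →
  countD (suc k) h (k ∷ map (shiftAbove k) v)
    ≡ countD k h (map (swap k) (k ∷ map (shiftAbove k) v)) + countB k (h ∘ suc) v
countD-swap-at-head k h v
  rewrite swap-k k | <⇒<ᵇ-true (ℕP.n<1+n k) | ≮⇒<ᵇ-false (ℕP.<⇒≯ (ℕP.n<1+n k)) =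
  countB-relabel (shiftAbove k) (shiftAbove-preserves-order k) (h ∘ suc) (shiftAbove-≤ ℕP.≤-refl) tt
                 (All.universal (λ _ → tt) v)

countB-max≡countD-max : ∀ m {h h′} → (∀ j → h j ≡ h′ (suc j)) → ∀ {u} → All (_≤ m) u →
  countB (suc m) h u ≡ countD (suc m) h′ u
countB-max≡countD-max m eq [] = cong (λ b → if b then 1 else 0) (eq 0)
countB-max≡countD-max m eq {b ∷ u} (b≤m ∷ _)
  rewrite ≮⇒<ᵇ-false (ℕP.<⇒≯ (s≤s b≤m)) | <⇒<ᵇ-true (s≤s b≤m) =
  trans (ℕP.+-identityʳ _) (signCount-cong _ b u eq)

≤⇒≢suc : ∀ {z j} → z ≤ j → z ≢ suc j
≤⇒≢suc z≤j refl = ℕP.<-irrefl refl (s≤s z≤j)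

>⇒≢ : ∀ {z k} → k < z → z ≢ k
>⇒≢ k<z refl = ℕP.<-irrefl refl k<z

VSB-max≡VSD-max : ∀ m e → VSB (suc m) (suc m) e ≡ VSD (suc m) (suc m) (e ℤ.+ - (+ 2))
VSB-max≡VSD-max m e = begin
    VSB (suc m) (suc m) e
  ≡⟨ VSB-fibres (suc m) (suc m) e ⟩
    sumBy (withHead (suc m) (countB (suc m) h)) (perms (range1 (suc m)))
  ≡⟨ without-max (countB (suc m) h) ⟩
    sumBy (countB (suc m) h) (perms below)
  ≡⟨ sumBy-cong-∈ (perms below) (countB-max≡countD-max m shift ∘ ∈-perms-All below≤m) ⟩
    sumBy (countD (suc m) h′) (perms below)
  ≡⟨ without-max (countD (suc m) h′) ⟨
    sumBy (withHead (suc m) (countD (suc m) h′)) (perms (range1 (suc m)))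
  ≡⟨ VSD-fibres (suc m) (suc m) (e ℤ.+ - (+ 2)) ⟨
    VSD (suc m) (suc m) (e ℤ.+ - (+ 2))
  ∎
  where
  open ≡-Reasoning
  h = expoIs (suc m) e
  h′ = expoIs (suc m) (e ℤ.+ - (+ 2))
  shift : ∀ i → h i ≡ h′ (suc i)
  shift = expoIs-sucʳ (suc m) e
  below = interval 0 m
  below≤m : All (_≤ m) below
  below≤m = interval-≤ 0 m
  without-max : ∀ G → sumBy (withHead (suc m) G) (perms (range1 (suc m))) ≡ sumBy G (perms below)
  without-max G = begin
      sumBy (withHead (suc m) G) (perms (range1 (suc m)))
    ≡⟨ cong (sumBy (withHead (suc m) G) ∘ perms) range≡ ⟩
      sumBy (withHead (suc m) G) (perms (below ++ suc m ∷ []))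
    ≡⟨ sumBy-withHead-perms (suc m) (All.map ≤⇒≢suc below≤m) [] G ⟩
      sumBy G (perms (below ++ []))
    ≡⟨ cong (sumBy G ∘ perms) (ListP.++-identityʳ below) ⟩
      sumBy G (perms below)
    ∎
    where
    range≡ : range1 (suc m) ≡ below ++ suc m ∷ []
    range≡ = trans (range1≡interval (suc m)) (trans (cong (interval 0) (ℕP.+-comm 1 m)) (interval-++ 0 m 1))

-- The values 1, …, n listed as below, k, k+1, above, where k = j+1; above′ is above shifted down by one.
module Window (j m : ℕ) where

  k n : ℕ
  k = suc j
  n = suc (suc (j + m))

  below above above′ : List ℕ
  below = interval 0 j
  above = interval (suc k) m
  above′ = interval k m

  below≢k : All (_≢ k) below
  below≢k = All.map ≤⇒≢suc (interval-≤ 0 j)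

  below≢sk : All (_≢ suc k) below
  below≢sk = All.map (≤⇒≢suc ∘ ℕP.m≤n⇒m≤1+n) (interval-≤ 0 j)

  above≢sk : All (_≢ suc k) above
  above≢sk = All.map >⇒≢ (interval-> (suc k) m)

  above≢k : All (_≢ k) above
  above≢k = All.map (>⇒≢ ∘ ℕP.<-trans (ℕP.n<1+n k)) (interval-> (suc k) m)

  above′≢k : All (_≢ k) above′
  above′≢k = All.map >⇒≢ (interval-> k m)

  k≢sk : k ≢ suc k
  k≢sk = ℕP.1+n≢n ∘ sym

  range-n : range1 n ≡ below ++ k ∷ suc k ∷ above
  range-n = trans (range1≡interval n)
                  (trans (cong (interval 0) (sym (trans (ℕP.+-suc j (suc m)) (cong suc (ℕP.+-suc j m)))))
                         (interval-++ 0 j (suc (suc m))))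

  range-n-1 : range1 (suc (j + m)) ≡ below ++ k ∷ above′
  range-n-1 = trans (range1≡interval (suc (j + m)))
                    (trans (cong (interval 0) (sym (ℕP.+-suc j m))) (interval-++ 0 j (suc m)))

  without-k : ∀ G → sumBy (withHead k G) (perms (range1 n)) ≡ sumBy G (perms (below ++ suc k ∷ above))
  without-k G = trans (cong (sumBy (withHead k G) ∘ perms) range-n)
                      (sumBy-withHead-perms k below≢k (k≢sk ∘ sym ∷ above≢k) G)

  without-sk : ∀ G → sumBy (withHead (suc k) G) (perms (range1 n)) ≡ sumBy G (perms (below ++ k ∷ above))
  without-sk G = begin
      sumBy (withHead (suc k) G) (perms (range1 n))
    ≡⟨ cong (sumBy (withHead (suc k) G) ∘ perms)
            (trans range-n (sym (ListP.++-assoc below (k ∷ []) (suc k ∷ above)))) ⟩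
      sumBy (withHead (suc k) G) (perms ((below ++ k ∷ []) ++ suc k ∷ above))
    ≡⟨ sumBy-withHead-perms (suc k) (++⁺ below≢sk (k≢sk ∷ [])) above≢sk G ⟩
      sumBy G (perms ((below ++ k ∷ []) ++ above))
    ≡⟨ cong (sumBy G ∘ perms) (ListP.++-assoc below (k ∷ []) above) ⟩
      sumBy G (perms (below ++ k ∷ above))
    ∎
    where open ≡-Reasoning

  without-k′ : ∀ G → sumBy (withHead k G) (perms (range1 (suc (j + m)))) ≡ sumBy G (perms (below ++ above′))
  without-k′ G = trans (cong (sumBy (withHead k G) ∘ perms) range-n-1)
                       (sumBy-withHead-perms k below≢k above′≢k G)

  swap-fixes : ∀ {xs} → All (_≢ k) xs → All (_≢ suc k) xs → map (swap k) xs ≡ xs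
  swap-fixes xs≢k xs≢sk =
    ListP.map-id-local (All.zipWith (λ (z≢k , z≢sk) → swap-other z≢k z≢sk) (xs≢k , xs≢sk))

  swap-sk-list : map (swap k) (below ++ suc k ∷ above) ≡ below ++ k ∷ above
  swap-sk-list = trans (ListP.map-++ (swap k) below (suc k ∷ above))
                       (cong₂ _++_ (swap-fixes below≢k below≢sk)
                                   (cong₂ _∷_ (swap-suc k) (swap-fixes above≢k above≢sk)))

  swap-k-list : map (swap k) (below ++ k ∷ above) ≡ below ++ suc k ∷ above
  swap-k-list = trans (ListP.map-++ (swap k) below (k ∷ above))
                      (cong₂ _++_ (swap-fixes below≢k below≢sk)
                                  (cong₂ _∷_ (swap-k k) (swap-fixes above≢k above≢sk)))

  shift-above′ : map (shiftAbove k) (below ++ above′) ≡ below ++ above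
  shift-above′ = trans (ListP.map-++ (shiftAbove k) below above′)
    (cong₂ _++_ (ListP.map-id-local (All.map (shiftAbove-≤ ∘ ℕP.m≤n⇒m≤1+n) (interval-≤ 0 j)))
                (trans (ListP.map-cong-local (All.map shiftAbove-> (interval-> k m))) (map-suc-interval k m)))

  VSB-recurrence : ∀ e → VSB n k e ≡ VSB n (suc k) e + VSD (suc (j + m)) k (e ℤ.+ - (+ 1))
  VSB-recurrence e = begin
      VSB n k e
    ≡⟨ VSB-fibres n k e ⟩
      sumBy (withHead k (countB k h)) (perms (range1 n))
    ≡⟨ without-k (countB k h) ⟩
      sumBy (countB k h) (perms (below ++ suc k ∷ above))
    ≡⟨ sumBy-perms-exchange (suc k) below≢sk above≢sk (swap k) (shiftAbove k) swap-sk-list shift-above′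
         (countB k h) (countB (suc k) h) (countD k h′) off-head at-head ⟩
      sumBy (countB (suc k) h) (perms (below ++ k ∷ above)) + sumBy (countD k h′) (perms (below ++ above′))
    ≡⟨ cong₂ _+_ (without-sk (countB (suc k) h)) (without-k′ (countD k h′)) ⟨
      sumBy (withHead (suc k) (countB (suc k) h)) (perms (range1 n))
      + sumBy (withHead k (countD k h′)) (perms (range1 (suc (j + m))))
    ≡⟨ cong₂ _+_ (VSB-fibres n (suc k) e) (VSD-fibres (suc (j + m)) k (e ℤ.+ - (+ 1))) ⟨
      VSB n (suc k) e + VSD (suc (j + m)) k (e ℤ.+ - (+ 1))
    ∎
    where
    open ≡-Reasoning
    h = expoIs n e
    h′ = expoIs (suc (j + m)) (e ℤ.+ - (+ 1))
    off-head : ∀ {u} → u ∈ perms (below ++ suc k ∷ above) →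
      withoutHead (suc k) (countB k h) u ≡ withoutHead (suc k) (countB (suc k) h ∘ map (swap k)) u
    off-head = countB-swap-off-head k h ∘ ∈-perms-All (++⁺ below≢k (k≢sk ∘ sym ∷ above≢k))
    at-head : ∀ {v} → v ∈ perms (below ++ above′) →
      countB k h (suc k ∷ map (shiftAbove k) v)
        ≡ countB (suc k) h (map (swap k) (suc k ∷ map (shiftAbove k) v)) + countD k h′ v
    at-head {v} v∈ = trans (countB-swap-at-head k h (∈-perms-All (++⁺ below≢k above′≢k) v∈))
      (cong (_+_ _) (countD-cong k v (expoIs-sucˡ (suc (j + m)) e)))

  VSD-recurrence : ∀ e → VSD n (suc k) e ≡ VSD n k e + VSB (suc (j + m)) k (e ℤ.+ + 1)
  VSD-recurrence e = begin
      VSD n (suc k) e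
    ≡⟨ VSD-fibres n (suc k) e ⟩
      sumBy (withHead (suc k) (countD (suc k) h)) (perms (range1 n))
    ≡⟨ without-sk (countD (suc k) h) ⟩
      sumBy (countD (suc k) h) (perms (below ++ k ∷ above))
    ≡⟨ sumBy-perms-exchange k below≢k above≢k (swap k) (shiftAbove k) swap-k-list shift-above′
         (countD (suc k) h) (countD k h) (countB k h′) off-head at-head ⟩
      sumBy (countD k h) (perms (below ++ suc k ∷ above)) + sumBy (countB k h′) (perms (below ++ above′))
    ≡⟨ cong₂ _+_ (without-k (countD k h)) (without-k′ (countB k h′)) ⟨
      sumBy (withHead k (countD k h)) (perms (range1 n))
      + sumBy (withHead k (countB k h′)) (perms (range1 (suc (j + m))))
    ≡⟨ cong₂ _+_ (VSD-fibres n k e) (VSB-fibres (suc (j + m)) k (e ℤ.+ + 1)) ⟨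
      VSD n k e + VSB (suc (j + m)) k (e ℤ.+ + 1)
    ∎
    where
    open ≡-Reasoning
    h = expoIs n e
    h′ = expoIs (suc (j + m)) (e ℤ.+ + 1)
    off-head : ∀ {u} → u ∈ perms (below ++ k ∷ above) →
      withoutHead k (countD (suc k) h) u ≡ withoutHead k (countD k h ∘ map (swap k)) u
    off-head = countD-swap-off-head k h ∘ ∈-perms-All (++⁺ below≢sk (k≢sk ∷ above≢sk))
    at-head : ∀ {v} → v ∈ perms (below ++ above′) →
      countD (suc k) h (k ∷ map (shiftAbove k) v)
        ≡ countD k h (map (swap k) (k ∷ map (shiftAbove k) v)) + countB k h′ v
    at-head {v} _ = trans (countD-swap-at-head k h v)
      (cong (_+_ _) (signCount-cong _ k v (expoIs-sucˡʳ (suc (j + m)) e)))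

proposition4p1 : (∀ (n k : ℕ) → 1 < k → k ≤ n →
       VSD n k ≈L VSD n (k ∸ 1) ⊕ (tpow· (- (+ 1))) (VSB (n ∸ 1) (k ∸ 1)))
    × (∀ (n : ℕ) → 2 ≤ n → VSB n n ≈L (tpow· (+ 2)) (VSD n n))
    × (∀ (n k : ℕ) → 1 ≤ k → k < n →
       VSB n k ≈L VSB n (k + 1) ⊕ (tpow· (+ 1)) (VSD (n ∸ 1) k))
proposition4p1 = VSD-identity , VSB-max-identity , VSB-identity
  where
  VSD-identity : ∀ n k → 1 < k → k ≤ n →
                 VSD n k ≈L VSD n (k ∸ 1) ⊕ (tpow· (- (+ 1))) (VSB (n ∸ 1) (k ∸ 1))
  VSD-identity n (suc (suc j)) (s≤s (s≤s _)) k≤n with ℕP.m≤n⇒∃[o]m+o≡n k≤n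
  ... | m , refl = Window.VSD-recurrence j m
  VSB-max-identity : ∀ n → 2 ≤ n → VSB n n ≈L (tpow· (+ 2)) (VSD n n)
  VSB-max-identity (suc m) _ = VSB-max≡VSD-max m
  VSB-identity : ∀ n k → 1 ≤ k → k < n → VSB n k ≈L VSB n (k + 1) ⊕ (tpow· (+ 1)) (VSD (n ∸ 1) k)
  VSB-identity n (suc j) _ k<n with ℕP.m≤n⇒∃[o]m+o≡n k<n
  ... | m , refl = λ e → trans (Window.VSB-recurrence j m e)
    (cong (λ k′ → VSB (suc (suc (j + m))) k′ e + VSD (suc (j + m)) (suc j) (e ℤ.+ - (+ 1)))
          (ℕP.+-comm 1 (suc j)))
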